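{- Let $(\Omega,S)$ be a 4-equivalenced association scheme and let $s,t\in S$ with $s\notin\langle t\rangle$ and $t\notin\langle s\rangle$. Then $A_sA_t=A_{a_1}+A_{a_2}+A_{a_3}+A_{a_4}$ for four distinct elements $a_1,a_2,a_3,a_4\in S$, none of which lies in $\langle s\rangle\cup\langle t\rangle$.
   Context: An association scheme $(\Omega,S)$: $\Omega$ finite, $S$ a partition of $\Omega\times\Omega$ containing $1_\Omega=\{(x,x)\}$, closed under $s\mapsto s^*=\{(y,x):(x,y)\in s\}$, such that $c_{st}^r=|\{z:(x,z)\in s,(z,y)\in t\}|$ is independent of $(x,y)\in r$. It is 4-equivalenced if $c_{ss^*}^{1_\Omega}=4$ for every $s\neq1_\Omega$. $A_s$ is the 0/1 adjacency matrix of $s$ (indexed by $\Omega$), so $A_sA_t=\sum_w c_{st}^wA_w$. For $R,T\subseteq S$, $RT=\{u\in S: c_{rt}^u\neq 0$ for some $r\in R,t\in T\}$ and $R^*=\{r^*:r\in R\}$; $R$ is closed if $R^*R\subseteq R$; $\langle R\rangle$ is the intersection of all closed subsets containing $R$, and $\langle s\rangle=\langle\{s\}\rangle$. -}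

module Defs where

open import Data.Nat using (ℕ; zero; suc; _+_; _*_)
open import Data.Fin using (Fin; zero; suc; _≟_)
open import Data.Fin.Subset using (Subset; _∈_)
open import Data.Product using (Σ; _×_; _,_; proj₁; proj₂)
open import Data.Sum using (_⊎_)
open import Data.Bool using (if_then_else_)
open import Relation.Nullary using (¬_; does)
open import Relation.Binary.PropositionalEquality using (_≡_; _≢_)
open import Function.Bundles using (_⇔_)

sumFin : ∀ {n} → (Fin n → ℕ) → ℕ
sumFin {zero} f = 0
sumFin {suc n} f = f zero + sumFin (λ i → f (suc i))

[_≟_] : ∀ {m} → Fin m → Fin m → ℕ
[ a ≟ b ] = if does (a ≟ b) then 1 else 0

-- An association scheme on Ω = Fin n with relation set S = Fin m.
-- The partition S of Ω×Ω is given by the map `rel` sending a pair to the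
-- (index of the) class containing it; every class is nonempty (`rep`).
record AssocScheme (n m : ℕ) : Set where
  field
    rel      : Fin n → Fin n → Fin m
    rep      : Fin m → Fin n × Fin n
    rep-rel  : ∀ r → rel (proj₁ (rep r)) (proj₂ (rep r)) ≡ r
    one      : Fin m
    one-diag : ∀ x y → rel x y ≡ one ⇔ x ≡ y
    star     : Fin m → Fin m
    star-rel : ∀ x y → rel y x ≡ star (rel x y)

  N : Fin n → Fin n → Fin m → Fin m → ℕ
  N x y s t = sumFin (λ z → [ rel x z ≟ s ] * [ rel z y ≟ t ])

  A : Fin m → Fin n → Fin n → ℕ
  A s x y = [ rel x y ≟ s ]

  _·_ : (Fin n → Fin n → ℕ) → (Fin n → Fin n → ℕ) → Fin n → Fin n → ℕ
  (M · M') x y = sumFin (λ z → M x z * M' z y)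

  c : Fin m → Fin m → Fin m → ℕ
  c s t r = N (proj₁ (rep r)) (proj₂ (rep r)) s t

  -- a subset R ⊆ S is closed if R*R ⊆ R
  Closed : Subset m → Set
  Closed R = ∀ r t u → r ∈ R → t ∈ R → c (star r) t u ≢ 0 → u ∈ R

  _∈⟨_⟩ : Fin m → Fin m → Set
  u ∈⟨ s ⟩ = ∀ R → Closed R → s ∈ R → u ∈ R

record IsAssocScheme {n m : ℕ} (X : AssocScheme n m) : Set where
  open AssocScheme X
  field
    const : ∀ x y x' y' s t → rel x y ≡ rel x' y' → N x y s t ≡ N x' y' s t

FourEquivalenced : ∀ {n m} → AssocScheme n m → Set
FourEquivalenced X = ∀ s → s ≢ one → c s (star s) one ≡ 4
  where open AssocScheme X

module Submission where

-- Finally (module Product), closed sets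
-- separating s from t and t from s exclude two s·t-paths between two points,
-- so every c_{st}^u ≤ 1; fixing (x₀, z₀) ∈ s, reciprocity writes A_s A_t as
-- the sum of A_{rel x₀ y} over the four t-neighbours y of z₀, these four
-- relations are distinct because c_{st}^u ≤ 1, and the triangle x₀ z₀ y keeps
-- them outside ⟨s⟩ ∪ ⟨t⟩.

open import Defs
open import Data.Bool using (if_then_else_)
open import Data.Empty using (⊥; ⊥-elim)
open import Data.Fin using (Fin; zero; suc; _≟_)
open import Data.Fin.Properties using (suc-injective; any?; ¬∀⟶∃¬)
open import Data.Fin.Subset using (Subset; _∈_; _∉_)
open import Data.Fin.Subset.Properties using (_∈?_)
open import Data.List using (List; []; _∷_; length; map)
open import Data.List.Membership.Propositional using () renaming (_∈_ to _∈ₗ_)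
open import Data.List.Properties using (length-map)
open import Data.List.Relation.Unary.All as All using (All; []; _∷_)
import Data.List.Relation.Unary.All.Properties as All
open import Data.List.Relation.Unary.AllPairs using ([]; _∷_)
open import Data.List.Relation.Unary.Any using (here; there)
open import Data.List.Relation.Unary.Unique.Propositional using (Unique)
open import Data.Nat using (ℕ; zero; suc; _+_; _*_; _∸_; _≤_; _<_; z≤n; s≤s; _≤?_)
open import Data.Nat.Divisibility using (_∣_; _∣0; ∣-refl; m∣m*n; ∣m∣n⇒∣m+n; ∣m+n∣m⇒∣n; ∣1⇒≡1)
open import Data.Nat.Properties hiding (_≟_; suc-injective)
open import Data.Nat.Tactic.RingSolver using (solve-∀)
open import Algebra.Properties.CommutativeSemigroup +-commutativeSemigroup
  using () renaming (interchange to +-interchange; xy∙z≈y∙xz to +-move-middle)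
open import Algebra.Properties.CommutativeSemigroup *-commutativeSemigroup
  using () renaming (x∙yz≈y∙xz to *-swap-outer)
open import Data.Product using (Σ; _×_; _,_; proj₁; proj₂)
open import Data.Sum using (_⊎_; inj₁; inj₂)
open import Function.Bundles using (Equivalence)
open import Relation.Binary.PropositionalEquality using (_≡_; _≢_; refl; sym; trans; cong; cong₂; subst; ≢-sym; module ≡-Reasoning)
open ≡-Reasoning
open import Relation.Nullary using (¬_; yes; no; does)
open import Relation.Nullary.Decidable using (_×-dec_; _→-dec_; decidable-stable)

private variable
  n m : ℕ

δ-yes : {a b : Fin m} → a ≡ b → [ a ≟ b ] ≡ 1
δ-yes {a = a} {b} a≡b with a ≟ b
... | yes _ = refl
... | no a≢b = ⊥-elim (a≢b a≡b)

δ-no : {a b : Fin m} → a ≢ b → [ a ≟ b ] ≡ 0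
δ-no {a = a} {b} a≢b with a ≟ b
... | yes a≡b = ⊥-elim (a≢b a≡b)
... | no _ = refl

δ-pos : {a b : Fin m} → 0 < [ a ≟ b ] → a ≡ b
δ-pos {a = a} {b} pos with a ≟ b
... | yes a≡b = a≡b
δ-pos {a = a} {b} () | no _

δ-≤1 : (a b : Fin m) → [ a ≟ b ] ≤ 1
δ-≤1 a b with a ≟ b
... | yes _ = s≤s z≤n
... | no _ = z≤n

δ-cong : ∀ {k} {a b : Fin m} {c d : Fin k} → (a ≡ b → c ≡ d) → (c ≡ d → a ≡ b) →
  [ a ≟ b ] ≡ [ c ≟ d ]
δ-cong {a = a} {b} to from with a ≟ b
... | yes a≡b = sym (δ-yes (to a≡b))
... | no a≢b = sym (δ-no (λ c≡d → a≢b (from c≡d)))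

δ-sym : (a b : Fin m) → [ a ≟ b ] ≡ [ b ≟ a ]
δ-sym a b = δ-cong {a = a} {b} {c = b} {d = a} sym sym

δ-subst : (w : Fin m → ℕ) (a b : Fin m) → [ a ≟ b ] * w a ≡ [ a ≟ b ] * w b
δ-subst w a b with a ≟ b
... | yes refl = refl
... | no _ = refl

δ-idem : (a b : Fin m) → [ a ≟ b ] * [ a ≟ b ] ≡ [ a ≟ b ]
δ-idem a b with a ≟ b
... | yes _ = refl
... | no _ = refl

δδ-pos : ∀ {k} {a b : Fin m} {c d : Fin k} → 0 < [ a ≟ b ] * [ c ≟ d ] → a ≡ b × c ≡ d
δδ-pos {a = a} {b} {c} {d} pos with a ≟ b | c ≟ d
... | yes a≡b | yes c≡d = a≡b , c≡d
δδ-pos () | yes _ | no _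
δδ-pos () | no _ | _

δδ-≤1 : ∀ {k} (a b : Fin m) (c d : Fin k) → [ a ≟ b ] * [ c ≟ d ] ≤ 1
δδ-≤1 a b c d = *-mono-≤ (δ-≤1 a b) (δ-≤1 c d)

δ*-one : {a b : Fin m} {r : ℕ} → a ≡ b → r ≡ 1 → [ a ≟ b ] * r ≡ 1
δ*-one a≡b r≡1 = cong₂ _*_ (δ-yes a≡b) r≡1

sumFin-cong : {f g : Fin n → ℕ} → (∀ i → f i ≡ g i) → sumFin f ≡ sumFin g
sumFin-cong {zero} f≗g = refl
sumFin-cong {suc n} f≗g = cong₂ _+_ (f≗g zero) (sumFin-cong (λ i → f≗g (suc i)))

sumFin-zero : {f : Fin n → ℕ} → (∀ i → f i ≡ 0) → sumFin f ≡ 0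
sumFin-zero {zero} f≗0 = refl
sumFin-zero {suc n} f≗0 = cong₂ _+_ (f≗0 zero) (sumFin-zero (λ i → f≗0 (suc i)))

sumFin-+ : (f g : Fin n → ℕ) → sumFin (λ i → f i + g i) ≡ sumFin f + sumFin g
sumFin-+ {zero} f g = refl
sumFin-+ {suc n} f g =
  trans (cong (f zero + g zero +_) (sumFin-+ (λ i → f (suc i)) (λ i → g (suc i))))
        (+-interchange (f zero) (g zero) _ _)

sumFin-*ˡ : (k : ℕ) (f : Fin n → ℕ) → sumFin (λ i → k * f i) ≡ k * sumFin f
sumFin-*ˡ {zero} k f = sym (*-zeroʳ k)
sumFin-*ˡ {suc n} k f =
  trans (cong (k * f zero +_) (sumFin-*ˡ k (λ i → f (suc i)))) (sym (*-distribˡ-+ k (f zero) _))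

sumFin-*ʳ : (k : ℕ) (f : Fin n → ℕ) → sumFin (λ i → f i * k) ≡ sumFin f * k
sumFin-*ʳ k f = trans (sumFin-cong (λ i → *-comm (f i) k)) (trans (sumFin-*ˡ k f) (*-comm k _))

∣-sumFin : (k : ℕ) (f : Fin n → ℕ) → (∀ i → k ∣ f i) → k ∣ sumFin f
∣-sumFin {zero} k f k∣f = k ∣0
∣-sumFin {suc n} k f k∣f = ∣m∣n⇒∣m+n (k∣f zero) (∣-sumFin k (λ i → f (suc i)) (λ i → k∣f (suc i)))

sumFin-swap : (f : Fin n → Fin m → ℕ) →
  sumFin (λ i → sumFin (λ j → f i j)) ≡ sumFin (λ j → sumFin (λ i → f i j))
sumFin-swap {zero} {m} f = sym (sumFin-zero {m} (λ j → refl))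
sumFin-swap {suc n} f =
  trans (cong (sumFin (f zero) +_) (sumFin-swap (λ i → f (suc i))))
        (sym (sumFin-+ (f zero) (λ j → sumFin (λ i → f (suc i) j))))

sumFin-δ : (p : Fin n) (f : Fin n → ℕ) → sumFin (λ q → [ q ≟ p ] * f q) ≡ f p
sumFin-δ {suc n} zero f =
  trans (cong (λ r → f zero + 0 + r) (sumFin-zero (λ i → cong (_* f (suc i)) (δ-no {a = suc i} {b = zero} (λ ())))))
        (trans (+-identityʳ _) (+-identityʳ _))
sumFin-δ {suc n} (suc p) f = sumFin-δ p (λ i → f (suc i))

sumFin-δ-one : (p : Fin n) → sumFin (λ q → [ q ≟ p ]) ≡ 1
sumFin-δ-one {n} p = trans (sumFin-cong {n} (λ q → sym (*-identityʳ [ q ≟ p ]))) (sumFin-δ p (λ _ → 1))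

term≤sumFin : (f : Fin n → ℕ) (i : Fin n) → f i ≤ sumFin f
term≤sumFin f zero = m≤m+n _ _
term≤sumFin f (suc i) = ≤-trans (term≤sumFin (λ j → f (suc j)) i) (m≤n+m _ (f zero))

pair≤sumFin : (f : Fin n → ℕ) {i j : Fin n} → i ≢ j → f i + f j ≤ sumFin f
pair≤sumFin f {zero} {zero} i≢j = ⊥-elim (i≢j refl)
pair≤sumFin f {zero} {suc j} _ = +-monoʳ-≤ (f zero) (term≤sumFin (λ k → f (suc k)) j)
pair≤sumFin f {suc i} {zero} _ =
  ≤-trans (≤-reflexive (+-comm (f (suc i)) (f zero))) (+-monoʳ-≤ (f zero) (term≤sumFin (λ k → f (suc k)) i))
pair≤sumFin f {suc i} {suc j} i≢j =
  ≤-trans (pair≤sumFin (λ k → f (suc k)) (λ i≡j → i≢j (cong suc i≡j))) (m≤n+m _ (f zero))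

triple≤sumFin : (f : Fin n → ℕ) {i j k : Fin n} → i ≢ j → i ≢ k → j ≢ k →
  f i + f j + f k ≤ sumFin f
triple≤sumFin f {zero} {zero} i≢j _ _ = ⊥-elim (i≢j refl)
triple≤sumFin f {zero} {suc _} {zero} _ i≢k _ = ⊥-elim (i≢k refl)
triple≤sumFin f {suc _} {zero} {zero} _ _ j≢k = ⊥-elim (j≢k refl)
triple≤sumFin f {zero} {suc j} {suc k} _ _ j≢k =
  ≤-trans (≤-reflexive (+-assoc (f zero) _ _))
          (+-monoʳ-≤ (f zero) (pair≤sumFin (λ l → f (suc l)) (λ j≡k → j≢k (cong suc j≡k))))
triple≤sumFin f {suc i} {zero} {suc k} _ i≢k _ =
  ≤-trans (≤-reflexive (+-move-middle (f (suc i)) (f zero) (f (suc k))))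
          (+-monoʳ-≤ (f zero) (pair≤sumFin (λ l → f (suc l)) (λ i≡k → i≢k (cong suc i≡k))))
triple≤sumFin f {suc i} {suc j} {zero} i≢j _ _ =
  ≤-trans (≤-reflexive (+-comm (f (suc i) + f (suc j)) (f zero)))
          (+-monoʳ-≤ (f zero) (pair≤sumFin (λ l → f (suc l)) (λ i≡j → i≢j (cong suc i≡j))))
triple≤sumFin f {suc i} {suc j} {suc k} i≢j i≢k j≢k =
  ≤-trans (triple≤sumFin (λ l → f (suc l)) (λ e → i≢j (cong suc e)) (λ e → i≢k (cong suc e))
                                           (λ e → j≢k (cong suc e)))
          (m≤n+m _ (f zero))

positive-term : (f : Fin n → ℕ) → 0 < sumFin f → Σ (Fin n) λ i → 0 < f i
positive-term {suc n} f pos with f zero in eq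
... | suc _ = zero , subst (0 <_) (sym eq) (s≤s z≤n)
... | zero with positive-term (λ i → f (suc i)) pos
...   | i , fi>0 = suc i , fi>0

two-positive-terms : (f : Fin n → ℕ) → (∀ i → f i ≤ 1) → 2 ≤ sumFin f →
  Σ (Fin n) λ i → Σ (Fin n) λ j → i ≢ j × 0 < f i × 0 < f j
two-positive-terms {suc n} f f≤1 two with f zero in eq | f≤1 zero
... | zero | _ with two-positive-terms (λ i → f (suc i)) (λ i → f≤1 (suc i)) two
...   | i , j , i≢j , fi>0 , fj>0 = suc i , suc j , (λ e → i≢j (suc-injective e)) , fi>0 , fj>0
two-positive-terms {suc n} f f≤1 two | suc zero | _ with positive-term (λ i → f (suc i)) (≤-pred two)
...   | i , fi>0 = zero , suc i , (λ ()) , subst (0 <_) (sym eq) (s≤s z≤n) , fi>0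
two-positive-terms {suc n} f f≤1 two | suc (suc _) | s≤s ()

count : Fin n → List (Fin n) → ℕ
count q [] = 0
count q (p ∷ K) = [ q ≟ p ] + count q K

count-suc-zero : (K : List (Fin n)) → count zero (map suc K) ≡ 0
count-suc-zero [] = refl
count-suc-zero (p ∷ K) = count-suc-zero K

count-suc : (q : Fin n) (K : List (Fin n)) → count (suc q) (map suc K) ≡ count q K
count-suc q [] = refl
count-suc q (p ∷ K) = cong ([ q ≟ p ] +_) (count-suc q K)

support : (f : Fin n → ℕ) → (∀ i → f i ≤ 1) → Σ (List (Fin n)) λ K → ∀ q → f q ≡ count q K
support {zero} f f≤1 = [] , λ ()
support {suc n} f f≤1 with support (λ i → f (suc i)) (λ i → f≤1 (suc i)) | f zero in eq | f≤1 zero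
... | K , fK | zero | _ =
  map suc K , λ { zero → trans eq (sym (count-suc-zero K)) ; (suc q) → trans (fK q) (sym (count-suc q K)) }
... | K , fK | suc zero | _ =
  zero ∷ map suc K , λ { zero → trans eq (cong suc (sym (count-suc-zero K)))
                       ; (suc q) → trans (fK q) (sym (count-suc q K)) }
... | K , fK | suc (suc _) | s≤s ()

sumFin-count : (K : List (Fin n)) → sumFin (λ q → count q K) ≡ length K
sumFin-count {n} [] = sumFin-zero {n} (λ _ → refl)
sumFin-count (p ∷ K) =
  trans (sumFin-+ (λ q → [ q ≟ p ]) (λ q → count q K)) (cong₂ _+_ (sumFin-δ-one p) (sumFin-count K))

sumFin-count-map : (K : List (Fin n)) (g : Fin n → Fin m) (v : Fin m) →
  sumFin (λ q → count q K * [ v ≟ g q ]) ≡ count v (map g K)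
sumFin-count-map {n} [] g v = sumFin-zero {n} (λ _ → refl)
sumFin-count-map (p ∷ K) g v =
  trans (sumFin-cong (λ q → *-distribʳ-+ [ v ≟ g q ] [ q ≟ p ] (count q K)))
  (trans (sumFin-+ (λ q → [ q ≟ p ] * [ v ≟ g q ]) (λ q → count q K * [ v ≟ g q ]))
         (cong₂ _+_ (sumFin-δ p (λ q → [ v ≟ g q ])) (sumFin-count-map K g v)))

count-∈ : {q : Fin n} {K : List (Fin n)} → q ∈ₗ K → 0 < count q K
count-∈ {q = q} {.q ∷ K} (here refl) = subst (λ r → 0 < r + count q K) (sym (δ-yes {a = q} refl)) (s≤s z≤n)
count-∈ {q = q} {p ∷ K} (there q∈K) = ≤-trans (count-∈ q∈K) (m≤n+m _ [ q ≟ p ])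

count-absent : {v : Fin n} (K : List (Fin n)) → All (v ≢_) K → count v K ≡ 0
count-absent [] [] = refl
count-absent (p ∷ K) (v≢p ∷ rest) = cong₂ _+_ (δ-no v≢p) (count-absent K rest)

count≤1⇒unique : (K : List (Fin n)) → (∀ v → count v K ≤ 1) → Unique K
count≤1⇒unique [] _ = []
count≤1⇒unique (p ∷ K) count≤1 =
  All.tabulate (λ {q} q∈K p≡q → twice q q∈K p≡q) ∷ count≤1⇒unique K (λ v → ≤-trans (m≤n+m _ _) (count≤1 v))
  where
  twice : ∀ q → q ∈ₗ K → p ≡ q → ⊥
  twice q q∈K refl with count≤1 p
  ... | le rewrite δ-yes {a = p} refl = <⇒≱ (s≤s (count-∈ q∈K)) le

four-elements : ∀ {P : Fin m → Set} {F : Fin n → Fin n → ℕ} {g : Fin n → Fin n → Fin m}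
  (K : List (Fin m)) → length K ≡ 4 → Unique K → All P K → (∀ x y → F x y ≡ count (g x y) K) →
  Σ (Fin m) λ a₁ → Σ (Fin m) λ a₂ → Σ (Fin m) λ a₃ → Σ (Fin m) λ a₄ →
    (a₁ ≢ a₂ × a₁ ≢ a₃ × a₁ ≢ a₄ × a₂ ≢ a₃ × a₂ ≢ a₄ × a₃ ≢ a₄)
    × (P a₁ × P a₂ × P a₃ × P a₄)
    × (∀ x y → F x y ≡ [ g x y ≟ a₁ ] + [ g x y ≟ a₂ ] + [ g x y ≟ a₃ ] + [ g x y ≟ a₄ ])
four-elements {g = g} (a₁ ∷ a₂ ∷ a₃ ∷ a₄ ∷ []) refl
  ((a₁≢a₂ ∷ a₁≢a₃ ∷ a₁≢a₄ ∷ []) ∷ (a₂≢a₃ ∷ a₂≢a₄ ∷ []) ∷ (a₃≢a₄ ∷ []) ∷ [] ∷ [])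
  (p₁ ∷ p₂ ∷ p₃ ∷ p₄ ∷ []) F≡count =
  a₁ , a₂ , a₃ , a₄ , (a₁≢a₂ , a₁≢a₃ , a₁≢a₄ , a₂≢a₃ , a₂≢a₄ , a₃≢a₄) , (p₁ , p₂ , p₃ , p₄) ,
  λ x y → trans (F≡count x y) (reassociate [ g x y ≟ a₁ ] [ g x y ≟ a₂ ] [ g x y ≟ a₃ ] [ g x y ≟ a₄ ])
  where
  reassociate : ∀ i j k l → i + (j + (k + (l + 0))) ≡ i + j + k + l
  reassociate = solve-∀
four-elements [] () _ _ _
four-elements (_ ∷ []) () _ _ _
four-elements (_ ∷ _ ∷ []) () _ _ _
four-elements (_ ∷ _ ∷ _ ∷ []) () _ _ _
four-elements (_ ∷ _ ∷ _ ∷ _ ∷ _ ∷ _) () _ _ _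

χ : Subset m → Fin m → ℕ
χ R b = if does (b ∈? R) then 1 else 0

χ-yes : {R : Subset m} {b : Fin m} → b ∈ R → χ R b ≡ 1
χ-yes {R = R} {b} b∈R with b ∈? R
... | yes _ = refl
... | no b∉R = ⊥-elim (b∉R b∈R)

χ-no : {R : Subset m} {b : Fin m} → b ∉ R → χ R b ≡ 0
χ-no {R = R} {b} b∉R with b ∈? R
... | yes b∈R = ⊥-elim (b∉R b∈R)
... | no _ = refl

χ-≤1 : (R : Subset m) (b : Fin m) → χ R b ≤ 1
χ-≤1 R b with b ∈? R
... | yes _ = s≤s z≤n
... | no _ = z≤n

module Scheme {n m : ℕ} (X : AssocScheme n m) (isA : IsAssocScheme X) where
  open AssocScheme X
  open IsAssocScheme isA

  star-involutive : ∀ a → star (star a) ≡ a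
  star-involutive a = begin
    star (star a)           ≡⟨ cong (λ r → star (star r)) (sym xy≡a) ⟩
    star (star (rel x y))   ≡⟨ cong star (sym (star-rel x y)) ⟩
    star (rel y x)          ≡⟨ sym (star-rel y x) ⟩
    rel x y                 ≡⟨ xy≡a ⟩
    a                       ∎
    where
    x y : Fin n
    x = proj₁ (rep a)
    y = proj₂ (rep a)
    xy≡a : rel x y ≡ a
    xy≡a = rep-rel a

  star-injective : ∀ {a b} → star a ≡ star b → a ≡ b
  star-injective {a} {b} eq =
    trans (sym (star-involutive a)) (trans (cong star eq) (star-involutive b))

  rel-flip : ∀ {x y a} → rel x y ≡ a → rel y x ≡ star a
  rel-flip {x} {y} xy≡a = trans (star-rel x y) (cong star xy≡a)

  δ-flip : ∀ p q b → [ rel q p ≟ star b ] ≡ [ rel p q ≟ b ]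
  δ-flip p q b = δ-cong (λ e → star-injective (trans (sym (star-rel p q)) e)) rel-flip

  rel-refl : ∀ x → rel x x ≡ one
  rel-refl x = Equivalence.from (one-diag x x) refl

  rel-one : ∀ {x y} → rel x y ≡ one → x ≡ y
  rel-one {x} {y} = Equivalence.to (one-diag x y)

  c-at : ∀ {x y r} a b → rel x y ≡ r → c a b r ≡ N x y a b
  c-at {x} {y} {r} a b xy≡r = const _ _ x y a b (trans (rep-rel r) (sym xy≡r))

  path⇒N-pos : ∀ {x y z a b} → rel x z ≡ a → rel z y ≡ b → 0 < N x y a b
  path⇒N-pos {x} {y} {z} {a} {b} xz≡a zy≡b =
    ≤-trans (≤-reflexive (sym (δ*-one xz≡a (δ-yes zy≡b))))
            (term≤sumFin (λ z → [ rel x z ≟ a ] * [ rel z y ≟ b ]) z)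

  N-pos⇒path : ∀ {x y a b} → 0 < N x y a b → Σ (Fin n) λ z → rel x z ≡ a × rel z y ≡ b
  N-pos⇒path pos with positive-term _ pos
  ... | z , term>0 = z , δδ-pos term>0

  two-paths⇒N≥2 : ∀ {x y z₁ z₂ a b} → z₁ ≢ z₂ → rel x z₁ ≡ a → rel z₁ y ≡ b →
    rel x z₂ ≡ a → rel z₂ y ≡ b → 2 ≤ N x y a b
  two-paths⇒N≥2 {x} {y} {a = a} {b} z₁≢z₂ xz₁ z₁y xz₂ z₂y =
    ≤-trans (≤-reflexive (sym (cong₂ _+_ (δ*-one xz₁ (δ-yes z₁y)) (δ*-one xz₂ (δ-yes z₂y)))))
            (pair≤sumFin (λ z → [ rel x z ≟ a ] * [ rel z y ≟ b ]) z₁≢z₂)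

  N≥2-avoid : ∀ {x y a b} → 2 ≤ N x y a b → (w : Fin n) →
    Σ (Fin n) λ z → z ≢ w × rel x z ≡ a × rel z y ≡ b
  N≥2-avoid {x} {y} {a} {b} two w
    with two-positive-terms _ (λ z → δδ-≤1 (rel x z) a (rel z y) b) two
  ... | z₁ , z₂ , z₁≢z₂ , p₁ , p₂ with z₁ ≟ w
  ...   | yes refl = z₂ , (λ z₂≡z₁ → z₁≢z₂ (sym z₂≡z₁)) , δδ-pos p₂
  ...   | no z₁≢w = z₁ , z₁≢w , δδ-pos p₁

  valency : Fin n → Fin m → ℕ
  valency x a = sumFin (λ q → [ rel x q ≟ a ])

  valency-one : ∀ x → valency x one ≡ 1
  valency-one x = trans (sumFin-cong (λ q → δ-cong {a = rel x q} {c = q} (λ e → sym (rel-one e))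
                                                  (λ { refl → rel-refl x })))
                        (sumFin-δ-one x)

  nbhd-sum : ∀ x a (h : Fin n → ℕ) r → (∀ q → rel x q ≡ a → h q ≡ r) →
    sumFin (λ q → [ rel x q ≟ a ] * h q) ≡ valency x a * r
  nbhd-sum x a h r h≡r = trans (sumFin-cong term) (sumFin-*ʳ r (λ q → [ rel x q ≟ a ]))
    where
    term : ∀ q → [ rel x q ≟ a ] * h q ≡ [ rel x q ≟ a ] * r
    term q with rel x q ≟ a
    ... | yes xq≡a = cong (1 *_) (h≡r q xq≡a)
    ... | no _ = refl

  sum-partition : ∀ x (g : Fin n → ℕ) →
    sumFin g ≡ sumFin (λ b → sumFin (λ q → [ rel x q ≟ b ] * g q))
  sum-partition x g = trans (sumFin-cong split) (sumFin-swap (λ q b → [ rel x q ≟ b ] * g q))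
    where
    split : ∀ q → g q ≡ sumFin (λ b → [ rel x q ≟ b ] * g q)
    split q = sym (begin
      sumFin (λ b → [ rel x q ≟ b ] * g q)   ≡⟨ sumFin-*ʳ (g q) (λ b → [ rel x q ≟ b ]) ⟩
      sumFin (λ b → [ rel x q ≟ b ]) * g q   ≡⟨ cong (_* g q) (trans (sumFin-cong (λ b → δ-sym (rel x q) b))
                                                                      (sumFin-δ-one (rel x q))) ⟩
      1 * g q                                ≡⟨ *-identityˡ (g q) ⟩
      g q                                    ∎)

  sum-by-relation : ∀ z (w : Fin m → ℕ) →
    sumFin (λ q → w (rel z q)) ≡ sumFin (λ b → valency z b * w b)
  sum-by-relation z w =
    trans (sum-partition z (λ q → w (rel z q)))
          (sumFin-cong (λ b → nbhd-sum z b (λ q → w (rel z q)) (w b) (λ q zq≡b → cong w zq≡b)))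

  -- Double counting of triangles:  k_v c_{ab}^v = k_a c_{v b*}^a.
  valency-reciprocity : ∀ {x' y' x z} v a b → rel x' y' ≡ v → rel x z ≡ a →
    valency x v * N x' y' a b ≡ valency x a * N x z v (star b)
  valency-reciprocity {x'} {y'} {x} {z} v a b x'y'≡v xz≡a = begin
    valency x v * N x' y' a b                      ≡⟨ sym (nbhd-sum x v (λ q → N x q a b) _
                                                          (λ q xq≡v → const x q x' y' a b (trans xq≡v (sym x'y'≡v)))) ⟩
    sumFin (λ q → [ rel x q ≟ v ] * N x q a b)     ≡⟨ sumFin-cong (λ q → sym (sumFin-*ˡ [ rel x q ≟ v ] (λ p → [ rel x p ≟ a ] * [ rel p q ≟ b ]))) ⟩
    sumFin (λ q → sumFin (λ p → triangle q p))     ≡⟨ sumFin-swap triangle ⟩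
    sumFin (λ p → sumFin (λ q → triangle q p))     ≡⟨ sumFin-cong (λ p → trans (sumFin-cong (reorder p))
                                                        (sumFin-*ˡ [ rel x p ≟ a ] (λ q → [ rel x q ≟ v ] * [ rel q p ≟ star b ]))) ⟩
    sumFin (λ p → [ rel x p ≟ a ] * N x p v (star b)) ≡⟨ nbhd-sum x a (λ p → N x p v (star b)) _
                                                          (λ p xp≡a → const x p x z v (star b) (trans xp≡a (sym xz≡a))) ⟩
    valency x a * N x z v (star b)                 ∎
    where
    triangle : Fin n → Fin n → ℕ
    triangle q p = [ rel x q ≟ v ] * ([ rel x p ≟ a ] * [ rel p q ≟ b ])
    reorder : ∀ p q → triangle q p ≡ [ rel x p ≟ a ] * ([ rel x q ≟ v ] * [ rel q p ≟ star b ])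
    reorder p q = trans (*-swap-outer [ rel x q ≟ v ] [ rel x p ≟ a ] _)
                        (cong (λ r → [ rel x p ≟ a ] * ([ rel x q ≟ v ] * r)) (sym (δ-flip p q b)))

  weighted : (Fin m → ℕ) → Fin n → Fin m → Fin n → ℕ
  weighted w x a z = sumFin (λ q → [ rel x q ≟ a ] * w (rel z q))

  weighted-by-N : ∀ w x a z → weighted w x a z ≡ sumFin (λ b → w b * N x z a (star b))
  weighted-by-N w x a z =
    trans (sum-partition z (λ q → [ rel x q ≟ a ] * w (rel z q)))
          (sumFin-cong (λ b → trans (sumFin-cong (term b)) (sumFin-*ˡ (w b) (λ q → [ rel x q ≟ a ] * [ rel q z ≟ star b ]))))
    where
    term : ∀ b q → [ rel z q ≟ b ] * ([ rel x q ≟ a ] * w (rel z q))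
                 ≡ w b * ([ rel x q ≟ a ] * [ rel q z ≟ star b ])
    term b q = begin
      [ rel z q ≟ b ] * ([ rel x q ≟ a ] * w (rel z q))  ≡⟨ *-swap-outer [ rel z q ≟ b ] [ rel x q ≟ a ] (w (rel z q)) ⟩
      [ rel x q ≟ a ] * ([ rel z q ≟ b ] * w (rel z q))  ≡⟨ cong ([ rel x q ≟ a ] *_) (δ-subst w (rel z q) b) ⟩
      [ rel x q ≟ a ] * ([ rel z q ≟ b ] * w b)          ≡⟨ cong ([ rel x q ≟ a ] *_) (*-comm [ rel z q ≟ b ] (w b)) ⟩
      [ rel x q ≟ a ] * (w b * [ rel z q ≟ b ])          ≡⟨ *-swap-outer [ rel x q ≟ a ] (w b) _ ⟩
      w b * ([ rel x q ≟ a ] * [ rel z q ≟ b ])          ≡⟨ cong (λ r → w b * ([ rel x q ≟ a ] * r)) (sym (δ-flip z q b)) ⟩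
      w b * ([ rel x q ≟ a ] * [ rel q z ≟ star b ])     ∎

  weighted-invariant : ∀ w x a {z z'} → rel x z ≡ rel x z' → weighted w x a z ≡ weighted w x a z'
  weighted-invariant w x a {z} {z'} eq =
    trans (weighted-by-N w x a z)
          (trans (sumFin-cong (λ b → cong (w b *_) (const x z x z' a (star b) eq)))
                 (sym (weighted-by-N w x a z')))

  module Closure {R : Subset m} (closed : Closed R) where

    -- The defining property of closedness, read on points: if q sees p and
    -- r through R then so does p see r (as c_{(qp)* (qr)}^{(pr)} ≠ 0).

    closed-step : ∀ {p q r} → rel q p ∈ R → rel q r ∈ R → rel p r ∈ R
    closed-step {p} {q} {r} qp∈R qr∈R = closed (rel q p) (rel q r) (rel p r) qp∈R qr∈R
      (n>0⇒n≢0 (subst (0 <_) (sym (trans (cong (λ a → c a (rel q r) (rel p r)) (sym (star-rel q p)))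
                                          (c-at (rel p q) (rel q r) refl)))
                      (path⇒N-pos refl refl)))

    one∈ : ∀ {b} → b ∈ R → one ∈ R
    one∈ {b} b∈R = subst (_∈ R) (rel-refl (proj₂ (rep b)))
                         (closed-step (subst (_∈ R) (sym (rep-rel b)) b∈R) (subst (_∈ R) (sym (rep-rel b)) b∈R))

    flip∈ : ∀ {p q} → rel p q ∈ R → rel q p ∈ R
    flip∈ {p} pq∈R = closed-step pq∈R (subst (_∈ R) (sym (rel-refl p)) (one∈ pq∈R))

    star∈ : ∀ {b} → b ∈ R → star b ∈ R
    star∈ {b} b∈R = subst (_∈ R) (rel-flip (rep-rel b)) (flip∈ (subst (_∈ R) (sym (rep-rel b)) b∈R))

    trans∈ : ∀ {p q r} → rel p q ∈ R → rel q r ∈ R → rel p r ∈ R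
    trans∈ pq∈R qr∈R = closed-step (flip∈ pq∈R) qr∈R

    co-successors∈ : ∀ {b p q y} → b ∈ R → rel p y ≡ b → rel q y ≡ b → rel p q ∈ R
    co-successors∈ b∈R py≡b qy≡b =
      trans∈ (subst (_∈ R) (sym py≡b) b∈R) (flip∈ (subst (_∈ R) (sym qy≡b) b∈R))

    co-predecessors∈ : ∀ {b p q x} → b ∈ R → rel x p ≡ b → rel x q ≡ b → rel p q ∈ R
    co-predecessors∈ b∈R xp≡b xq≡b =
      trans∈ (flip∈ (subst (_∈ R) (sym xp≡b) b∈R)) (subst (_∈ R) (sym xq≡b) b∈R)

  rel-unflip : ∀ {x y a} → rel x y ≡ star a → rel y x ≡ a
  rel-unflip {a = a} xy≡a* = trans (rel-flip xy≡a*) (star-involutive a)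

  -- To refute something from a separating pair of closed sets it suffices to
  -- know that neither of s, t generates the other (membership is decidable).
  separation : ∀ {s t} → ¬ (s ∈⟨ t ⟩) → ¬ (t ∈⟨ s ⟩) →
    (∀ {R R'} → Closed R → Closed R' → t ∈ R → s ∉ R → s ∈ R' → t ∉ R' → ⊥) → ⊥
  separation {s} {t} s∉⟨t⟩ t∉⟨s⟩ refute =
    s∉⟨t⟩ λ R closed t∈R → decidable-stable (s ∈? R) λ s∉R →
    t∉⟨s⟩ λ R' closed' s∈R' → decidable-stable (t ∈? R') λ t∉R' →
    refute closed closed' t∈R s∉R s∈R' t∉R'

  -- From here on every non-identity relation has valency 4.
  module Valency4 (four : FourEquivalenced X) where

    valency-4 : ∀ x a → a ≢ one → valency x a ≡ 4
    valency-4 x a a≢one = begin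
      valency x a        ≡⟨ sumFin-cong (λ q → sym (square q)) ⟩
      N x x a (star a)   ≡⟨ sym (c-at a (star a) (rel-refl x)) ⟩
      c a (star a) one   ≡⟨ four a a≢one ⟩
      4                  ∎
      where
      square : ∀ q → [ rel x q ≟ a ] * [ rel q x ≟ star a ] ≡ [ rel x q ≟ a ]
      square q = trans (cong ([ rel x q ≟ a ] *_) (δ-flip x q a)) (δ-idem (rel x q) a)

    reciprocity : ∀ {x' y' x z} v a b → v ≢ one → a ≢ one → rel x' y' ≡ v → rel x z ≡ a →
      N x' y' a b ≡ N x z v (star b)
    reciprocity {x'} {y'} {x} {z} v a b v≢one a≢one x'y'≡v xz≡a = *-cancelˡ-≡ _ _ 4 (begin
      4 * N x' y' a b                  ≡⟨ cong (_* N x' y' a b) (sym (valency-4 x v v≢one)) ⟩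
      valency x v * N x' y' a b        ≡⟨ valency-reciprocity v a b x'y'≡v xz≡a ⟩
      valency x a * N x z v (star b)   ≡⟨ cong (_* N x z v (star b)) (valency-4 x a a≢one) ⟩
      4 * N x z v (star b)             ∎)

    punctured : (Fin m → ℕ) → Fin m → ℕ
    punctured w b = if does (b ≟ one) then 0 else w b

    sum-by-relation-4 : ∀ z (w : Fin m → ℕ) →
      sumFin (λ q → w (rel z q)) ≡ w one + 4 * sumFin (punctured w)
    sum-by-relation-4 z w =
      trans (sum-by-relation z w)
      (trans (sumFin-cong term)
      (trans (sumFin-+ (λ b → [ b ≟ one ] * w b) (λ b → 4 * punctured w b))
             (cong₂ _+_ (sumFin-δ one w) (sumFin-*ˡ 4 (punctured w)))))
      where
      term : ∀ b → valency z b * w b ≡ [ b ≟ one ] * w b + 4 * punctured w b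
      term b with b ≟ one
      ... | yes refl = trans (cong (_* w one) (valency-one z)) (sym (+-identityʳ _))
      ... | no b≢one = cong (_* w b) (valency-4 z b b≢one)

    common-successors⇒N≥2 : ∀ {t z₁ z₂ y y'} → z₁ ≢ z₂ → y ≢ y' →
      rel z₁ y ≡ t → rel z₂ y ≡ t → rel z₁ y' ≡ t → rel z₂ y' ≡ t → 2 ≤ N z₁ y (rel z₁ z₂) t
    common-successors⇒N≥2 {t} {z₁} {z₂} z₁≢z₂ y≢y' z₁y z₂y z₁y' z₂y' =
      subst (2 ≤_) (sym (reciprocity t (rel z₁ z₂) t t≢one w≢one z₁y refl))
            (two-paths⇒N≥2 y≢y' z₁y (rel-flip z₂y) z₁y' (rel-flip z₂y'))
      where
      t≢one : t ≢ one
      t≢one t≡one = z₁≢z₂ (trans (rel-one (trans z₁y t≡one)) (sym (rel-one (trans z₂y t≡one))))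
      w≢one : rel z₁ z₂ ≢ one
      w≢one w≡one = z₁≢z₂ (rel-one w≡one)

    module _ {R : Subset m} (closed : Closed R) where
      open Closure closed

      saturated : ∀ {a x z q₀ q} → (∀ q → rel x q ≡ a → rel z q ∈ R) → rel x z ≡ a →
        rel x q₀ ≡ rel x q → rel z q₀ ∈ R → rel z q ∈ R
      saturated {a} {x} {z} {q₀} {q} all xz≡a xq₀≡xq zq₀∈R
        with N-pos⇒path (subst (0 <_) (const x q₀ x q a (rel z q₀) xq₀≡xq) (path⇒N-pos xz≡a refl))
      ... | z' , xz'≡a , z'q≡zq₀ = trans∈ (all z' xz'≡a) (subst (_∈ R) (sym z'q≡zq₀) zq₀∈R)

      block-divisible : ∀ {a x z} → a ∉ R → (∀ q → rel x q ≡ a → rel z q ∈ R) → rel x z ≡ a →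
        ∀ b → 4 ∣ sumFin (λ q → [ rel x q ≟ b ] * χ R (rel z q))
      block-divisible {a} {x} {z} a∉R all xz≡a b
        with any? (λ q → (rel x q ≟ b) ×-dec (rel z q ∈? R))
      ... | no none = subst (4 ∣_) (sym (sumFin-zero empty)) (4 ∣0)
        where
        empty : ∀ q → [ rel x q ≟ b ] * χ R (rel z q) ≡ 0
        empty q with rel x q ≟ b
        ... | yes xq≡b = cong (1 *_) (χ-no (λ zq∈R → none (q , xq≡b , zq∈R)))
        ... | no _ = refl
      ... | yes (q₀ , xq₀≡b , zq₀∈R) = subst (4 ∣_) (sym full) ∣-refl
        where
        b≢one : b ≢ one
        b≢one b≡one = a∉R (subst (_∈ R) xz≡a
          (flip∈ (subst (λ p → rel z p ∈ R) (sym (rel-one (trans xq₀≡b b≡one))) zq₀∈R)))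
        full : sumFin (λ q → [ rel x q ≟ b ] * χ R (rel z q)) ≡ 4 * 1
        full = trans (nbhd-sum x b (λ q → χ R (rel z q)) 1
                       (λ q xq≡b → χ-yes (saturated all xz≡a (trans xq₀≡b (sym xq≡b)) zq₀∈R)))
                     (cong (_* 1) (valency-4 x b b≢one))

      -- Otherwise the R-ball of z would have size both
      -- ≡ 1 (mod 4) (by valencies) and ≡ 0 (mod 4) (by the blocks above).
      parity : ∀ {a x z} → a ∉ R → rel x z ≡ a → ¬ (∀ q → rel x q ≡ a → rel z q ∈ R)
      parity {a} {x} {z} a∉R xz≡a all = 4∤1 (∣m+n∣m⇒∣n ball-divisible (m∣m*n (sumFin (punctured (χ R)))))
        where
        one∈R : one ∈ R
        one∈R = subst (_∈ R) (rel-refl z) (all z xz≡a)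
        ball : sumFin (λ q → χ R (rel z q)) ≡ 4 * sumFin (punctured (χ R)) + 1
        ball = trans (sum-by-relation-4 z (χ R)) (trans (cong (_+ 4 * sumFin (punctured (χ R))) (χ-yes one∈R)) (+-comm 1 _))
        ball-divisible : 4 ∣ 4 * sumFin (punctured (χ R)) + 1
        ball-divisible = subst (4 ∣_) (trans (sym (sum-partition x (λ q → χ R (rel z q)))) ball)
                               (∣-sumFin 4 _ (block-divisible a∉R all xz≡a))
        4∤1 : ¬ (4 ∣ 1)
        4∤1 4∣1 with ∣1⇒≡1 4∣1
        ... | ()

      -- By parity some a-neighbour z₄ is not R-related
      -- to z₁; then z₄ is R-related to at least 3 a-neighbours (as z₁ is, the
      -- count only depending on rel x z₄ = a) and unrelated to z₁, z₂, z₃,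
      -- which exceeds the valency 4.
      no-three-neighbours : ∀ {a x z₁ z₂ z₃} → a ∉ R →
        rel x z₁ ≡ a → rel x z₂ ≡ a → rel x z₃ ≡ a → z₁ ≢ z₂ → z₁ ≢ z₃ → z₂ ≢ z₃ →
        rel z₁ z₂ ∈ R → rel z₁ z₃ ∈ R → ⊥
      no-three-neighbours {a} {x} {z₁} {z₂} {z₃} a∉R xz₁ xz₂ xz₃ z₁≢z₂ z₁≢z₃ z₂≢z₃ z₁z₂∈R z₁z₃∈R
        with ¬∀⟶∃¬ n _ (λ q → (rel x q ≟ a) →-dec (rel z₁ q ∈? R)) (parity a∉R xz₁)
      ... | z₄ , z₄-escapes = 6≰4 (subst (6 ≤_) total (+-mono-≤ inside outside))
        where
        xz₄ : rel x z₄ ≡ a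
        xz₄ = decidable-stable (rel x z₄ ≟ a) (λ xz₄≢a → z₄-escapes (λ xz₄≡a → ⊥-elim (xz₄≢a xz₄≡a)))
        z₄∉ : ∀ {q} → rel z₁ q ∈ R → rel z₄ q ∉ R
        z₄∉ z₁q∈R z₄q∈R = z₄-escapes (λ _ → trans∈ z₁q∈R (flip∈ z₄q∈R))
        z₁z₁∈R : rel z₁ z₁ ∈ R
        z₁z₁∈R = subst (_∈ R) (sym (rel-refl z₁)) (one∈ z₁z₂∈R)
        a≢one : a ≢ one
        a≢one a≡one = z₁≢z₂ (trans (sym (rel-one (trans xz₁ a≡one))) (rel-one (trans xz₂ a≡one)))
        inside : 3 ≤ weighted (χ R) x a z₄
        inside = ≤-trans (≤-reflexive (sym (cong₂ _+_ (cong₂ _+_ (counted xz₁ z₁z₁∈R) (counted xz₂ z₁z₂∈R))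
                                                       (counted xz₃ z₁z₃∈R))))
                 (≤-trans (triple≤sumFin (λ q → [ rel x q ≟ a ] * χ R (rel z₁ q)) z₁≢z₂ z₁≢z₃ z₂≢z₃)
                          (≤-reflexive (weighted-invariant (χ R) x a (trans xz₁ (sym xz₄)))))
          where
          counted : ∀ {q} → rel x q ≡ a → rel z₁ q ∈ R → [ rel x q ≟ a ] * χ R (rel z₁ q) ≡ 1
          counted xq z₁q∈R = δ*-one xq (χ-yes z₁q∈R)
        outside : 3 ≤ weighted (λ b → 1 ∸ χ R b) x a z₄
        outside = ≤-trans (≤-reflexive (sym (cong₂ _+_ (cong₂ _+_ (missed xz₁ z₁z₁∈R) (missed xz₂ z₁z₂∈R))
                                                        (missed xz₃ z₁z₃∈R))))
                          (triple≤sumFin (λ q → [ rel x q ≟ a ] * (1 ∸ χ R (rel z₄ q))) z₁≢z₂ z₁≢z₃ z₂≢z₃)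
          where
          missed : ∀ {q} → rel x q ≡ a → rel z₁ q ∈ R → [ rel x q ≟ a ] * (1 ∸ χ R (rel z₄ q)) ≡ 1
          missed xq z₁q∈R = δ*-one xq (cong (1 ∸_) (χ-no (z₄∉ z₁q∈R)))
        total : weighted (χ R) x a z₄ + weighted (λ b → 1 ∸ χ R b) x a z₄ ≡ 4
        total = trans (sym (sumFin-+ (λ q → [ rel x q ≟ a ] * χ R (rel z₄ q)) (λ q → [ rel x q ≟ a ] * (1 ∸ χ R (rel z₄ q)))))
                (trans (sumFin-cong split) (valency-4 x a a≢one))
          where
          split : ∀ q → [ rel x q ≟ a ] * χ R (rel z₄ q) + [ rel x q ≟ a ] * (1 ∸ χ R (rel z₄ q))
                      ≡ [ rel x q ≟ a ]
          split q = trans (sym (*-distribˡ-+ [ rel x q ≟ a ] _ _))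
                          (trans (cong ([ rel x q ≟ a ] *_) (m+[n∸m]≡n (χ-≤1 R (rel z₄ q))))
                                 (*-identityʳ _))
        6≰4 : ¬ (6 ≤ 4)
        6≰4 (s≤s (s≤s (s≤s (s≤s ()))))

      -- Two points z₁ ≠ z₂ with rel z₁ z₂ ∈ R and t* ∉ R have no two distinct
      -- common t-successors y, y': otherwise y has two t-predecessors q₁, q₂
      -- with rel z₁ qᵢ = rel z₁ z₂ ∈ R, so that z₁, q₁, q₂ are t*-neighbours
      -- of y contradicting no-three-neighbours.
      no-two-common-successors : ∀ {t z₁ z₂ y y'} → star t ∉ R → z₁ ≢ z₂ → rel z₁ z₂ ∈ R → y ≢ y' →
        rel z₁ y ≡ t → rel z₂ y ≡ t → rel z₁ y' ≡ t → rel z₂ y' ≡ t → ⊥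
      no-two-common-successors {t} {z₁} {z₂} {y} {y'} t*∉R z₁≢z₂ z₁z₂∈R y≢y' z₁y z₂y z₁y' z₂y'
        with common-successors⇒N≥2 z₁≢z₂ y≢y' z₁y z₂y z₁y' z₂y'
      ... | two with N-pos⇒path (≤-trans (s≤s z≤n) two)
      ... | q₁ , z₁q₁ , q₁y with N≥2-avoid two q₁
      ... | q₂ , q₂≢q₁ , z₁q₂ , q₂y =
        no-three-neighbours t*∉R (rel-flip z₁y) (rel-flip q₁y) (rel-flip q₂y)
          (≢-from z₁q₁) (≢-from z₁q₂) (≢-sym q₂≢q₁)
          (subst (_∈ R) (sym z₁q₁) z₁z₂∈R) (subst (_∈ R) (sym z₁q₂) z₁z₂∈R)
        where
        ≢-from : ∀ {q} → rel z₁ q ≡ rel z₁ z₂ → z₁ ≢ q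
        ≢-from z₁q refl = z₁≢z₂ (rel-one (trans (sym z₁q) (rel-refl z₁)))

    module Product (s t : Fin m) (s∉⟨t⟩ : ¬ (s ∈⟨ t ⟩)) (t∉⟨s⟩ : ¬ (t ∈⟨ s ⟩)) where

      s≢one : s ≢ one
      s≢one s≡one = s∉⟨t⟩ (λ R closed t∈R → subst (_∈ R) (sym s≡one) (Closure.one∈ closed t∈R))

      t≢one : t ≢ one
      t≢one t≡one = t∉⟨s⟩ (λ R closed s∈R → subst (_∈ R) (sym t≡one) (Closure.one∈ closed s∈R))

      t≢s* : t ≢ star s
      t≢s* t≡s* = t∉⟨s⟩ (λ R closed s∈R → subst (_∈ R) (sym t≡s*) (Closure.star∈ closed s∈R))

      no-s·t-loop : ∀ {x y z} → rel x z ≡ s → rel z y ≡ t → rel x y ≢ one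
      no-s·t-loop {z = z} xz≡s zy≡t xy≡one =
        t≢s* (trans (sym zy≡t) (rel-flip (subst (λ p → rel p z ≡ s) (rel-one xy≡one) xz≡s)))

      -- Take such paths via z₁ ≠ z₂; by
      -- reciprocity there is y' ≠ y with rel x y' = rel x y and (y', z₁) ∈ t*,
      -- and then an s·t-path x → z' → y' with z' ≠ z₁.  If z' ≠ z₂ then
      -- z₁, z₂, z' are s-neighbours of x, pairwise R-related through t;
      -- if z' = z₂ then y, y' are common t-successors of z₁, z₂, which are
      -- R'-related through s.
      no-double-path : ∀ {R R'} → Closed R → Closed R' → t ∈ R → s ∉ R → s ∈ R' → t ∉ R' →
        ∀ x y → ¬ (2 ≤ N x y s t)
      no-double-path {R} {R'} closed closed' t∈R s∉R s∈R' t∉R' x y two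
        with N-pos⇒path (≤-trans (s≤s z≤n) two)
      ... | z₁ , xz₁ , z₁y with N≥2-avoid two z₁
      ... | z₂ , z₂≢z₁ , xz₂ , z₂y
        with N≥2-avoid (subst (2 ≤_) (reciprocity (rel x y) s t (no-s·t-loop xz₁ z₁y) s≢one refl xz₁) two) y
      ... | y' , y'≢y , xy'≡xy , y'z₁
        with N≥2-avoid (subst (2 ≤_) (const x y x y' s t (sym xy'≡xy)) two) z₁
      ... | z' , z'≢z₁ , xz' , z'y' with z' ≟ z₂
      ...   | no z'≢z₂ =
        no-three-neighbours closed s∉R xz₁ xz₂ xz' (≢-sym z₂≢z₁) (≢-sym z'≢z₁) (≢-sym z'≢z₂)
          (Closure.co-successors∈ closed t∈R z₁y z₂y)
          (Closure.co-successors∈ closed t∈R (rel-unflip y'z₁) z'y')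
      ...   | yes refl =
        no-two-common-successors closed' (λ t*∈R' → t∉R' (subst (_∈ R') (star-involutive t) (Closure.star∈ closed' t*∈R')))
          (≢-sym z₂≢z₁) (Closure.co-predecessors∈ closed' s∈R' xz₁ xz₂) (≢-sym y'≢y)
          z₁y z₂y (rel-unflip y'z₁) z'y'

      N≤1 : ∀ x y → N x y s t ≤ 1
      N≤1 x y with N x y s t ≤? 1
      ... | yes N≤1-here = N≤1-here
      ... | no N≰1 = ⊥-elim (separation s∉⟨t⟩ t∉⟨s⟩
                       (λ cl cl' t∈R s∉R s∈R' t∉R' → no-double-path cl cl' t∈R s∉R s∈R' t∉R' x y (≰⇒> N≰1)))

      x₀ z₀ : Fin n
      x₀ = proj₁ (rep s)
      z₀ = proj₂ (rep s)

      x₀z₀ : rel x₀ z₀ ≡ s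
      x₀z₀ = rep-rel s

      t-neighbours : Σ (List (Fin n)) λ K → ∀ q → [ rel z₀ q ≟ t ] ≡ count q K
      t-neighbours = support (λ q → [ rel z₀ q ≟ t ]) (λ q → δ-≤1 (rel z₀ q) t)

      L : List (Fin n)
      L = proj₁ t-neighbours

      L-count : ∀ q → [ rel z₀ q ≟ t ] ≡ count q L
      L-count = proj₂ t-neighbours

      L-neighbours : All (λ y → rel z₀ y ≡ t) L
      L-neighbours = All.tabulate (λ {y} y∈L → δ-pos (subst (0 <_) (sym (L-count y)) (count-∈ y∈L)))

      summands : List (Fin m)
      summands = map (rel x₀) L

      summands-length : length summands ≡ 4
      summands-length = trans (length-map (rel x₀) L)
        (trans (sym (sumFin-count L)) (trans (sym (sumFin-cong L-count)) (valency-4 z₀ t t≢one)))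

      -- A_s A_t = Σ_{y ∈ L} A_{rel x₀ y}: for u = rel x y ≠ 1 reciprocity gives
      -- c_{st}^u = c_{u t*}^s, which counts the t-neighbours y of z₀ with
      -- rel x₀ y = u; for u = 1 both sides vanish.
      product-formula : ∀ x y → N x y s t ≡ count (rel x y) summands
      product-formula x y with rel x y ≟ one
      ... | yes xy≡one = trans (n≤0⇒n≡0 (≮⇒≥ no-path)) (sym (count-absent summands (All.map⁺ (All.map not-xy L-neighbours))))
        where
        no-path : ¬ (0 < N x y s t)
        no-path pos with N-pos⇒path pos
        ... | z , xz≡s , zy≡t = no-s·t-loop xz≡s zy≡t xy≡one
        not-xy : ∀ {q} → rel z₀ q ≡ t → rel x y ≢ rel x₀ q
        not-xy z₀q≡t xy≡x₀q = no-s·t-loop x₀z₀ z₀q≡t (trans (sym xy≡x₀q) xy≡one)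
      ... | no xy≢one = begin
        N x y s t                                            ≡⟨ reciprocity (rel x y) s t xy≢one s≢one refl x₀z₀ ⟩
        N x₀ z₀ (rel x y) (star t)                           ≡⟨ sumFin-cong term ⟩
        sumFin (λ q → count q L * [ rel x y ≟ rel x₀ q ])    ≡⟨ sumFin-count-map L (rel x₀) (rel x y) ⟩
        count (rel x y) summands                             ∎
        where
        term : ∀ q → [ rel x₀ q ≟ rel x y ] * [ rel q z₀ ≟ star t ] ≡ count q L * [ rel x y ≟ rel x₀ q ]
        term q = trans (*-comm [ rel x₀ q ≟ rel x y ] _)
                       (cong₂ _*_ (trans (δ-flip z₀ q t) (L-count q)) (δ-sym (rel x₀ q) (rel x y)))

      summands-unique : Unique summands
      summands-unique = count≤1⇒unique summands λ v →
        subst (_≤ 1) (trans (product-formula _ _) (cong (λ u → count u summands) (rep-rel v)))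
              (N≤1 (proj₁ (rep v)) (proj₂ (rep v)))

      -- No summand lies in ⟨s⟩ ∪ ⟨t⟩: the triangle x₀ → z₀ → y (with sides
      -- s, t, a) would put t in ⟨s⟩ or s in ⟨t⟩.
      Outside : Fin m → Set
      Outside a = ¬ (a ∈⟨ s ⟩ ⊎ a ∈⟨ t ⟩)

      outside : ∀ {y} → rel z₀ y ≡ t → Outside (rel x₀ y)
      outside {y} z₀y (inj₁ a∈⟨s⟩) = t∉⟨s⟩ λ R closed s∈R →
        subst (_∈ R) z₀y (Closure.trans∈ closed (subst (_∈ R) (sym (rel-flip x₀z₀)) (Closure.star∈ closed s∈R))
                                                (a∈⟨s⟩ R closed s∈R))
      outside {y} z₀y (inj₂ a∈⟨t⟩) = s∉⟨t⟩ λ R closed t∈R →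
        subst (_∈ R) x₀z₀ (Closure.trans∈ closed (a∈⟨t⟩ R closed t∈R)
                                                (subst (_∈ R) (sym (rel-flip z₀y)) (Closure.star∈ closed t∈R)))

      summands-outside : All Outside summands
      summands-outside = All.map⁺ (All.map outside L-neighbours)

lemma3p7 : ∀ {n m} (X : AssocScheme n m) → IsAssocScheme X → FourEquivalenced X →
    let open AssocScheme X in
    (s t : Fin m) → ¬ (s ∈⟨ t ⟩) → ¬ (t ∈⟨ s ⟩) →
    Σ (Fin m) λ a₁ → Σ (Fin m) λ a₂ → Σ (Fin m) λ a₃ → Σ (Fin m) λ a₄ →
    (a₁ ≢ a₂ × a₁ ≢ a₃ × a₁ ≢ a₄ × a₂ ≢ a₃ × a₂ ≢ a₄ × a₃ ≢ a₄)
    × (¬ (a₁ ∈⟨ s ⟩ ⊎ a₁ ∈⟨ t ⟩) × ¬ (a₂ ∈⟨ s ⟩ ⊎ a₂ ∈⟨ t ⟩)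
    × ¬ (a₃ ∈⟨ s ⟩ ⊎ a₃ ∈⟨ t ⟩) × ¬ (a₄ ∈⟨ s ⟩ ⊎ a₄ ∈⟨ t ⟩))
    × (∀ x y → (A s · A t) x y ≡ A a₁ x y + A a₂ x y + A a₃ x y + A a₄ x y)
lemma3p7 X isA four s t s∉⟨t⟩ t∉⟨s⟩ =
  four-elements summands summands-length summands-unique summands-outside product-formula
  where
  open Scheme.Valency4 X isA four
  open Product s t s∉⟨t⟩ t∉⟨s⟩
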